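{- Let $A=\{a_1,\dots,a_\ell\}\subset\mathbb{Z}^d$ and let $\mathcal{M}$, $\mathcal{Z}$, $m_h(x)$ be as in the context. Given $m \in \mathcal{M}$, let $x=A_{\operatorname{mat}} m$ and $h=\operatorname{wt}(m)$. Then $\operatorname{supp}(m) \cap \operatorname{supp}(m_h(x)) = \emptyset$. Moreover, if there exists $v \in \mathcal{Z} \setminus \{0\}$ with $v^+\leq_{\operatorname{coord}} m$ and $v^-\leq_{\operatorname{coord}} m_h(x)$, then $v^+ = m$, $v^- = m_h(x)$, and $v=m-m_h(x)$.
   Context: For $m\in\mathbb{Z}^\ell$, $\operatorname{wt}(m)=\sum_i m_i$ and $\operatorname{supp}(m)=\{i: m_i\neq 0\}$; $u^+,u^-\in\mathbb{Z}_{\geqslant0}^\ell$ are given by $(u^+)_i=\max\{0,u_i\}$, $(u^-)_i=\max\{0,-u_i\}$. $A_{\operatorname{mat}}$ is the $d\times\ell$ matrix with columns $a_1,\dots,a_\ell$. $x\leq_{\operatorname{coord}}y$ means $x_i\leqslant y_i$ for all $i$; $\leq_{\operatorname{lex}}$ is the lexicographic order on $\mathbb{Z}^\ell$. For $h\geqslant0$ and $x\in hA$ (with $hA$ the $h$-fold sumset), $\operatorname{rep}_h(x)=\{m\in\mathbb{Z}_{\geqslant0}^\ell:\operatorname{wt}(m)=h, A_{\operatorname{mat}}m=x\}$ and $m_h(x)$ is its lexicographically minimal element. $\mathcal{U}=\bigcup_{h\geqslant0}\bigcup_{x\in hA}\{m\in\operatorname{rep}_h(x): m\neq m_h(x)\}$,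 and $\mathcal{M}=\{m\in\mathcal{U}: \text{for all } u\in\mathcal{U},\ u\leq_{\operatorname{coord}}m\Rightarrow u=m\}$. Finally $\mathcal{Z}=\{z\in\mathbb{Z}^\ell:\operatorname{wt}(z)=0,\ A_{\operatorname{mat}}z=0\}$. -}

module Defs where

open import Data.Nat using (ℕ; zero; suc; _<_)
import Data.Nat as ℕ
open import Data.Integer using (ℤ; +_; -[1+_]) renaming (_+_ to _+ℤ_; _*_ to _*ℤ_; _-_ to _-ℤ_)
open import Data.Fin using (Fin)
open import Data.Vec using (Vec; []; _∷_; map; zipWith; replicate; foldr; lookup)
open import Data.Product using (Σ; _×_)
open import Data.Sum using (_⊎_)
open import Relation.Binary.PropositionalEquality using (_≡_; _≢_)

-- Points of ℤ^k are vectors Vec ℤ k; A = {a_1,…,a_ℓ} ⊂ ℤ^d is a vector of ℓ columns.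
Mat : ℕ → ℕ → Set
Mat d ℓ = Vec (Vec ℤ d) ℓ

-- the columns are pairwise distinct (A is a set of ℓ elements)
Distinct : ∀ {d ℓ} → Mat d ℓ → Set
Distinct {ℓ = ℓ} A = ∀ (i j : Fin ℓ) → lookup A i ≡ lookup A j → i ≡ j

wt : ∀ {ℓ} → Vec ℕ ℓ → ℕ
wt = foldr _ ℕ._+_ 0

wtℤ : ∀ {ℓ} → Vec ℤ ℓ → ℤ
wtℤ = foldr _ _+ℤ_ (+ 0)

Amatℤ : ∀ {d ℓ} → Mat d ℓ → Vec ℤ ℓ → Vec ℤ d
Amatℤ {d} [] [] = replicate d (+ 0)
Amatℤ (a ∷ A) (z ∷ zs) = zipWith _+ℤ_ (map (z *ℤ_) a) (Amatℤ A zs)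

Amat : ∀ {d ℓ} → Mat d ℓ → Vec ℕ ℓ → Vec ℤ d
Amat A m = Amatℤ A (map +_ m)

_≤coord_ : ∀ {ℓ} → Vec ℕ ℓ → Vec ℕ ℓ → Set
_≤coord_ {ℓ} x y = ∀ (i : Fin ℓ) → lookup x i ℕ.≤ lookup y i

data _≤lex_ : ∀ {ℓ} → Vec ℕ ℓ → Vec ℕ ℓ → Set where
  lex-[] : [] ≤lex []
  lex-< : ∀ {ℓ x y} {xs ys : Vec ℕ ℓ} → x < y → (x ∷ xs) ≤lex (y ∷ ys)
  lex-≡ : ∀ {ℓ x y} {xs ys : Vec ℕ ℓ} → x ≡ y → xs ≤lex ys → (x ∷ xs) ≤lex (y ∷ ys)

Rep : ∀ {d ℓ} → Mat d ℓ → ℕ → Vec ℤ d → Vec ℕ ℓ → Set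
Rep A h x m = (wt m ≡ h) × (Amat A m ≡ x)

IsLexMin : ∀ {d ℓ} → Mat d ℓ → ℕ → Vec ℤ d → Vec ℕ ℓ → Set
IsLexMin A h x m0 = Rep A h x m0 × (∀ m → Rep A h x m → m0 ≤lex m)

InU : ∀ {d ℓ} → Mat d ℓ → Vec ℕ ℓ → Set
InU {d} {ℓ} A m = Σ ℕ λ h → Σ (Vec ℤ d) λ x →
  Rep A h x m × (∀ m0 → IsLexMin A h x m0 → m ≢ m0)

InM : ∀ {d ℓ} → Mat d ℓ → Vec ℕ ℓ → Set
InM {ℓ = ℓ} A m = InU A m × (∀ (u : Vec ℕ ℓ) → InU A u → u ≤coord m → u ≡ m)

InZ : ∀ {d ℓ} → Mat d ℓ → Vec ℤ ℓ → Set
InZ {d} A z = (wtℤ z ≡ + 0) × (Amatℤ A z ≡ replicate d (+ 0))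

pos : ℤ → ℕ
pos (+ n) = n
pos -[1+ n ] = 0

neg : ℤ → ℕ
neg (+ n) = 0
neg -[1+ n ] = suc n

_⁺ : ∀ {ℓ} → Vec ℤ ℓ → Vec ℕ ℓ
v ⁺ = map pos v

_⁻ : ∀ {ℓ} → Vec ℤ ℓ → Vec ℕ ℓ
v ⁻ = map neg v

DisjointSupp : ∀ {ℓ} → Vec ℕ ℓ → Vec ℕ ℓ → Set
DisjointSupp {ℓ} m m' = ∀ (i : Fin ℓ) → (lookup m i ≡ 0) ⊎ (lookup m' i ≡ 0)

diff : ∀ {ℓ} → Vec ℕ ℓ → Vec ℕ ℓ → Vec ℤ ℓ
diff = zipWith (λ a b → (+ a) -ℤ (+ b))

-- Both parts rest on one exchange argument. Write m = a + c and m_h(x) = b + c'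
-- with c, c' representing the same point with the same weight. Then b is the
-- lexicographic minimum of the fibre of a, and a, b lie in the same fibre; so if
-- a ≠ b then a ∈ 𝒰, and a ≤ m forces a = m by minimality of m, i.e. c = 0.
-- A common coordinate i of the supports gives c = c' = e_i, where a = b would
-- yield m = m_h(x); a vector v ∈ 𝒵 gives c = v⁺, c' = v⁻, where c = 0 would
-- yield v = 0. In the second case m_h(x) = (m - v⁺) + v⁻, and disjointness of
-- the supports then pins down v⁺ = m and v⁻ = m_h(x).
module Submission where

open import Defs
open import Data.Nat using (ℕ)
open import Data.Integer using (ℤ; +_)
open import Data.Vec using (Vec; replicate)
open import Data.Product using (_×_)
open import Relation.Binary.PropositionalEquality using (_≡_; _≢_)

open import Algebra.Bundles using (AbelianGroup)
open import Data.Empty using (⊥-elim)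
open import Data.Fin using (Fin) renaming (zero to fzero; suc to fsuc)
open import Data.Integer using (-[1+_]) renaming (_+_ to _+ℤ_; _*_ to _*ℤ_)
import Data.Integer.Properties as ℤₚ
open import Data.Nat using (zero; suc; _+_; _∸_; _≤_; z≤n)
import Data.Nat.Properties as ℕₚ
open import Data.Product using (_,_; proj₁; proj₂)
open import Data.Sum using (_⊎_; inj₁; inj₂)
open import Data.Vec using ([]; _∷_; map; zipWith; lookup)
open import Data.Vec.Properties using (∷-injective; ≡-dec; lookup-replicate)
open import Relation.Nullary using (yes; no)
open import Relation.Nullary.Decidable using (decidable-stable)
open import Relation.Binary.PropositionalEquality
  using (refl; sym; trans; cong; cong₂; subst₂; module ≡-Reasoning)

open import Algebra.Properties.CommutativeSemigroup ℕₚ.+-commutativeSemigroup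
  using () renaming (interchange to +-interchange)
open import Algebra.Properties.CommutativeSemigroup ℤₚ.+-commutativeSemigroup
  using () renaming (interchange to +ℤ-interchange)
open import Algebra.Properties.Group (AbelianGroup.group ℤₚ.+-0-abelianGroup)
  using () renaming (∙-cancelʳ to +ℤ-cancelʳ)

open ≡-Reasoning

private
  variable
    d ℓ n h : ℕ
    x : Vec ℤ d
    A : Mat d ℓ
    m m0 a b c c' : Vec ℕ ℓ

infixl 6 _⊕_ _⊞_ _⊟_

_⊕_ : Vec ℤ n → Vec ℤ n → Vec ℤ n
_⊕_ = zipWith _+ℤ_

_⊞_ : Vec ℕ n → Vec ℕ n → Vec ℕ n
_⊞_ = zipWith _+_

_⊟_ : Vec ℕ n → Vec ℕ n → Vec ℕ n
_⊟_ = zipWith _∸_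

⊕-identityˡ : (u : Vec ℤ n) → replicate n (+ 0) ⊕ u ≡ u
⊕-identityˡ [] = refl
⊕-identityˡ (p ∷ u) = cong₂ _∷_ (ℤₚ.+-identityˡ p) (⊕-identityˡ u)

⊕-interchange : (u v w z : Vec ℤ n) → (u ⊕ v) ⊕ (w ⊕ z) ≡ (u ⊕ w) ⊕ (v ⊕ z)
⊕-interchange [] [] [] [] = refl
⊕-interchange (p ∷ u) (q ∷ v) (r ∷ w) (s ∷ z) =
  cong₂ _∷_ (+ℤ-interchange p q r s) (⊕-interchange u v w z)

⊕-cancelʳ : (w u v : Vec ℤ n) → u ⊕ w ≡ v ⊕ w → u ≡ v
⊕-cancelʳ [] [] [] _ = refl
⊕-cancelʳ (r ∷ w) (p ∷ u) (q ∷ v) eq =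
  cong₂ _∷_ (+ℤ-cancelʳ r p q (proj₁ (∷-injective eq))) (⊕-cancelʳ w u v (proj₂ (∷-injective eq)))

map-*-distribʳ-+ : (p q : ℤ) (u : Vec ℤ n) → map ((p +ℤ q) *ℤ_) u ≡ map (p *ℤ_) u ⊕ map (q *ℤ_) u
map-*-distribʳ-+ p q [] = refl
map-*-distribʳ-+ p q (r ∷ u) = cong₂ _∷_ (ℤₚ.*-distribʳ-+ r p q) (map-*-distribʳ-+ p q u)

map-+-⊞ : (a b : Vec ℕ n) → map +_ (a ⊞ b) ≡ map +_ a ⊕ map +_ b
map-+-⊞ [] [] = refl
map-+-⊞ (_ ∷ a) (_ ∷ b) = cong (_ ∷_) (map-+-⊞ a b)

m⊟n⊞n≡m : {m k : Vec ℕ n} → k ≤coord m → (m ⊟ k) ⊞ k ≡ m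
m⊟n⊞n≡m {m = []} {[]} _ = refl
m⊟n⊞n≡m {m = _ ∷ _} {_ ∷ _} k≤m =
  cong₂ _∷_ (ℕₚ.m∸n+n≡m (k≤m fzero)) (m⊟n⊞n≡m (λ i → k≤m (fsuc i)))

m≤m⊞n : (a b : Vec ℕ n) → a ≤coord (a ⊞ b)
m≤m⊞n (p ∷ _) (q ∷ _) fzero = ℕₚ.m≤m+n p q
m≤m⊞n (_ ∷ a) (_ ∷ b) (fsuc i) = m≤m⊞n a b i

wt-⊞ : (a b : Vec ℕ n) → wt (a ⊞ b) ≡ wt a + wt b
wt-⊞ [] [] = refl
wt-⊞ (p ∷ a) (q ∷ b) = trans (cong (_+_ (p + q)) (wt-⊞ a b)) (+-interchange p q (wt a) (wt b))

wtℤ-⊕ : (u v : Vec ℤ n) → wtℤ (u ⊕ v) ≡ wtℤ u +ℤ wtℤ v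
wtℤ-⊕ [] [] = refl
wtℤ-⊕ (p ∷ u) (q ∷ v) = trans (cong ((p +ℤ q) +ℤ_) (wtℤ-⊕ u v)) (+ℤ-interchange p q (wtℤ u) (wtℤ v))

wtℤ-map-+ : (a : Vec ℕ n) → wtℤ (map +_ a) ≡ + wt a
wtℤ-map-+ [] = refl
wtℤ-map-+ (p ∷ a) = cong (+ p +ℤ_) (wtℤ-map-+ a)

Amatℤ-⊕ : (A : Mat d ℓ) (u v : Vec ℤ ℓ) → Amatℤ A (u ⊕ v) ≡ Amatℤ A u ⊕ Amatℤ A v
Amatℤ-⊕ {d} [] [] [] = sym (⊕-identityˡ (replicate d (+ 0)))
Amatℤ-⊕ (col ∷ A) (p ∷ u) (q ∷ v) = begin
  map ((p +ℤ q) *ℤ_) col ⊕ Amatℤ A (u ⊕ v)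
    ≡⟨ cong₂ _⊕_ (map-*-distribʳ-+ p q col) (Amatℤ-⊕ A u v) ⟩
  (map (p *ℤ_) col ⊕ map (q *ℤ_) col) ⊕ (Amatℤ A u ⊕ Amatℤ A v)
    ≡⟨ ⊕-interchange (map (p *ℤ_) col) (map (q *ℤ_) col) (Amatℤ A u) (Amatℤ A v) ⟩
  (map (p *ℤ_) col ⊕ Amatℤ A u) ⊕ (map (q *ℤ_) col ⊕ Amatℤ A v) ∎

Amat-⊞ : (A : Mat d ℓ) (a b : Vec ℕ ℓ) → Amat A (a ⊞ b) ≡ Amat A a ⊕ Amat A b
Amat-⊞ A a b = trans (cong (Amatℤ A) (map-+-⊞ a b)) (Amatℤ-⊕ A (map +_ a) (map +_ b))

≤lex-antisym : {a b : Vec ℕ n} → a ≤lex b → b ≤lex a → a ≡ b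
≤lex-antisym lex-[] _ = refl
≤lex-antisym (lex-< p<q) (lex-< q<p) = ⊥-elim (ℕₚ.<-asym p<q q<p)
≤lex-antisym (lex-< p<q) (lex-≡ refl _) = ⊥-elim (ℕₚ.<-irrefl refl p<q)
≤lex-antisym (lex-≡ refl _) (lex-< q<p) = ⊥-elim (ℕₚ.<-irrefl refl q<p)
≤lex-antisym (lex-≡ refl a≤b) (lex-≡ _ b≤a) = cong (_ ∷_) (≤lex-antisym a≤b b≤a)

⊞-cancelʳ-≤lex : (a b c : Vec ℕ n) → (a ⊞ c) ≤lex (b ⊞ c) → a ≤lex b
⊞-cancelʳ-≤lex [] [] [] lex-[] = lex-[]
⊞-cancelʳ-≤lex (p ∷ _) (q ∷ _) (r ∷ _) (lex-< lt) = lex-< (ℕₚ.+-cancelʳ-< r p q lt)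
⊞-cancelʳ-≤lex (p ∷ a) (q ∷ b) (r ∷ c) (lex-≡ eq le) =
  lex-≡ (ℕₚ.+-cancelʳ-≡ r p q eq) (⊞-cancelʳ-≤lex a b c le)

SameRep : Mat d ℓ → Vec ℕ ℓ → Vec ℕ ℓ → Set
SameRep A a b = Rep A (wt a) (Amat A a) b

Rep-⊞-replace : (A : Mat d ℓ) → Rep A h x (a ⊞ c) → SameRep A a b → Rep A h x (b ⊞ c)
Rep-⊞-replace {a = a} {c} {b} A (wt≡h , Amat≡x) (wtb≡wta , Amatb≡Amata) =
  trans (wt-⊞ b c) (trans (cong (λ s → s + wt c) wtb≡wta) (trans (sym (wt-⊞ a c)) wt≡h)) ,
  trans (Amat-⊞ A b c)
    (trans (cong (_⊕ Amat A c) Amatb≡Amata) (trans (sym (Amat-⊞ A a c)) Amat≡x))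

Rep-⊞-cancel : (A : Mat d ℓ) → Rep A h x (a ⊞ c) → Rep A h x (b ⊞ c') → SameRep A c c' → SameRep A a b
Rep-⊞-cancel {a = a} {c} {b} {c'} A (wtac , Amatac) (wtbc' , Amatbc') (wtc' , Amatc') =
  ℕₚ.+-cancelʳ-≡ (wt c) (wt b) (wt a) (begin
    wt b + wt c   ≡⟨ cong (_+_ (wt b)) (sym wtc') ⟩
    wt b + wt c'  ≡⟨ sym (wt-⊞ b c') ⟩
    wt (b ⊞ c')   ≡⟨ trans wtbc' (sym wtac) ⟩
    wt (a ⊞ c)    ≡⟨ wt-⊞ a c ⟩
    wt a + wt c   ∎) ,
  ⊕-cancelʳ (Amat A c) (Amat A b) (Amat A a) (begin
    Amat A b ⊕ Amat A c   ≡⟨ cong (Amat A b ⊕_) (sym Amatc') ⟩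
    Amat A b ⊕ Amat A c'  ≡⟨ sym (Amat-⊞ A b c') ⟩
    Amat A (b ⊞ c')       ≡⟨ trans Amatbc' (sym Amatac) ⟩
    Amat A (a ⊞ c)        ≡⟨ Amat-⊞ A a c ⟩
    Amat A a ⊕ Amat A c   ∎)

lexMin-unique : (A : Mat d ℓ) {p q : Vec ℕ ℓ} → IsLexMin A h x p → IsLexMin A h x q → p ≡ q
lexMin-unique A (p-rep , p-min) (q-rep , q-min) = ≤lex-antisym (p-min _ q-rep) (q-min _ p-rep)

lexMin-⊞ˡ : (A : Mat d ℓ) → IsLexMin A h x (b ⊞ c) → IsLexMin A (wt b) (Amat A b) b
lexMin-⊞ˡ {b = b} {c} A (bc-rep , bc-min) =
  (refl , refl) , λ b' bb' →
    ⊞-cancelʳ-≤lex b b' c (bc-min (b' ⊞ c) (Rep-⊞-replace {a = b} {c} A bc-rep bb'))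

InU⇒≢lexMin : (A : Mat d ℓ) → InU A m → IsLexMin A (wt m) (Amat A m) m0 → m ≢ m0
InU⇒≢lexMin {m0 = m0} A (h , x , (wt≡h , Amat≡x) , ≢lexMin) m0-min =
  ≢lexMin m0 (subst₂ (λ h x → IsLexMin A h x m0) wt≡h Amat≡x m0-min)

InM-⊞-cancel : (A : Mat d ℓ) → InM A m → IsLexMin A (wt m) (Amat A m) m0 →
  a ⊞ c ≡ m → b ⊞ c' ≡ m0 → SameRep A c c' → a ≢ b → wt c ≡ 0
InM-⊞-cancel {a = a} {c} {b} A (_ , m-minimal) m0-min refl refl cc' a≢b =
  ℕₚ.+-cancelˡ-≡ (wt a) (wt c) 0 (begin
    wt a + wt c  ≡⟨ sym (wt-⊞ a c) ⟩
    wt (a ⊞ c)   ≡⟨ cong wt (sym a≡a⊞c) ⟩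
    wt a         ≡⟨ sym (ℕₚ.+-identityʳ (wt a)) ⟩
    wt a + 0     ∎)
  where
  ab : SameRep A a b
  ab = Rep-⊞-cancel A (refl , refl) (proj₁ m0-min) cc'

  b-lexMin : IsLexMin A (wt a) (Amat A a) b
  b-lexMin = subst₂ (λ h x → IsLexMin A h x b) (proj₁ ab) (proj₂ ab) (lexMin-⊞ˡ A m0-min)

  a∈U : InU A a
  a∈U = wt a , Amat A a , (refl , refl) ,
        λ p p-lexMin a≡p → a≢b (trans a≡p (lexMin-unique A p-lexMin b-lexMin))

  a≡a⊞c : a ≡ a ⊞ c
  a≡a⊞c = m-minimal a a∈U (m≤m⊞n a c)

unit : Fin n → Vec ℕ n
unit {suc n} fzero = 1 ∷ replicate n 0
unit (fsuc i) = 0 ∷ unit i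

wt-replicate-0 : ∀ n → wt (replicate n 0) ≡ 0
wt-replicate-0 zero = refl
wt-replicate-0 (suc n) = wt-replicate-0 n

wt-unit : (i : Fin n) → wt (unit i) ≡ 1
wt-unit {suc n} fzero = cong suc (wt-replicate-0 n)
wt-unit (fsuc i) = wt-unit i

unit≤coord : (i : Fin n) (m : Vec ℕ n) → lookup m i ≢ 0 → unit i ≤coord m
unit≤coord fzero (_ ∷ _) mᵢ≢0 fzero = ℕₚ.n≢0⇒n>0 mᵢ≢0
unit≤coord fzero (_ ∷ _) _ (fsuc j) rewrite lookup-replicate j 0 = z≤n
unit≤coord (fsuc i) (_ ∷ _) _ fzero = z≤n
unit≤coord (fsuc i) (_ ∷ m) mᵢ≢0 (fsuc j) = unit≤coord i m mᵢ≢0 j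

InM⇒DisjointSupp-lexMin : (A : Mat d ℓ) → InM A m → IsLexMin A (wt m) (Amat A m) m0 → DisjointSupp m m0
InM⇒DisjointSupp-lexMin {m = m} {m0 = m0} A m∈M m0-min i
  with lookup m i ℕₚ.≟ 0 | lookup m0 i ℕₚ.≟ 0
... | yes mᵢ≡0 | _ = inj₁ mᵢ≡0
... | no _ | yes m0ᵢ≡0 = inj₂ m0ᵢ≡0
... | no mᵢ≢0 | no m0ᵢ≢0 =
  ⊥-elim (ℕₚ.1+n≢0 (trans (sym (wt-unit i))
    (InM-⊞-cancel A m∈M m0-min m-split m0-split (refl , refl) cancelled≢)))
  where
  m-split : (m ⊟ unit i) ⊞ unit i ≡ m
  m-split = m⊟n⊞n≡m (unit≤coord i m mᵢ≢0)

  m0-split : (m0 ⊟ unit i) ⊞ unit i ≡ m0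
  m0-split = m⊟n⊞n≡m (unit≤coord i m0 m0ᵢ≢0)

  cancelled≢ : m ⊟ unit i ≢ m0 ⊟ unit i
  cancelled≢ eq = InU⇒≢lexMin A (proj₁ m∈M) m0-min (begin
    m                        ≡⟨ sym m-split ⟩
    (m ⊟ unit i) ⊞ unit i    ≡⟨ cong (_⊞ unit i) eq ⟩
    (m0 ⊟ unit i) ⊞ unit i   ≡⟨ m0-split ⟩
    m0                       ∎)

⁺≡⊕⁻ : (v : Vec ℤ n) → map +_ (v ⁺) ≡ v ⊕ map +_ (v ⁻)
⁺≡⊕⁻ [] = refl
⁺≡⊕⁻ (+ k ∷ v) = cong₂ _∷_ (sym (ℤₚ.+-identityʳ (+ k))) (⁺≡⊕⁻ v)
⁺≡⊕⁻ (-[1+ k ] ∷ v) = cong₂ _∷_ (sym (ℤₚ.+-inverseˡ (+ suc k))) (⁺≡⊕⁻ v)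

≡diff⁺⁻ : (v : Vec ℤ n) → v ≡ diff (v ⁺) (v ⁻)
≡diff⁺⁻ [] = refl
≡diff⁺⁻ (+ k ∷ v) = cong₂ _∷_ (sym (ℤₚ.+-identityʳ (+ k))) (≡diff⁺⁻ v)
≡diff⁺⁻ (-[1+ k ] ∷ v) = cong (_ ∷_) (≡diff⁺⁻ v)

wt⁺≡0⇒wt⁻≡0⇒≡0 : (v : Vec ℤ n) → wt (v ⁺) ≡ 0 → wt (v ⁻) ≡ 0 → v ≡ replicate n (+ 0)
wt⁺≡0⇒wt⁻≡0⇒≡0 [] _ _ = refl
wt⁺≡0⇒wt⁻≡0⇒≡0 (+ zero ∷ v) wt⁺≡0 wt⁻≡0 = cong (_ ∷_) (wt⁺≡0⇒wt⁻≡0⇒≡0 v wt⁺≡0 wt⁻≡0)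

InZ⇒SameRep⁺⁻ : (A : Mat d ℓ) {v : Vec ℤ ℓ} → InZ A v → SameRep A (v ⁺) (v ⁻)
InZ⇒SameRep⁺⁻ A {v} (wtv≡0 , Amatv≡0) =
  ℤₚ.+-injective (sym (begin
    + wt (v ⁺)                           ≡⟨ sym (wtℤ-map-+ (v ⁺)) ⟩
    wtℤ (map +_ (v ⁺))                   ≡⟨ cong wtℤ (⁺≡⊕⁻ v) ⟩
    wtℤ (v ⊕ map +_ (v ⁻))               ≡⟨ wtℤ-⊕ v (map +_ (v ⁻)) ⟩
    wtℤ v +ℤ wtℤ (map +_ (v ⁻))          ≡⟨ cong (_+ℤ wtℤ (map +_ (v ⁻))) wtv≡0 ⟩
    + 0 +ℤ wtℤ (map +_ (v ⁻))            ≡⟨ ℤₚ.+-identityˡ _ ⟩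
    wtℤ (map +_ (v ⁻))                   ≡⟨ wtℤ-map-+ (v ⁻) ⟩
    + wt (v ⁻)                           ∎)) ,
  sym (begin
    Amatℤ A (map +_ (v ⁺))               ≡⟨ cong (Amatℤ A) (⁺≡⊕⁻ v) ⟩
    Amatℤ A (v ⊕ map +_ (v ⁻))           ≡⟨ Amatℤ-⊕ A v (map +_ (v ⁻)) ⟩
    Amatℤ A v ⊕ Amat A (v ⁻)             ≡⟨ cong (_⊕ Amat A (v ⁻)) Amatv≡0 ⟩
    replicate _ (+ 0) ⊕ Amat A (v ⁻)     ≡⟨ ⊕-identityˡ _ ⟩
    Amat A (v ⁻)                         ∎)

InM-exchange-InZ : (A : Mat d ℓ) → InM A m → IsLexMin A (wt m) (Amat A m) m0 →
  {v : Vec ℤ ℓ} → InZ A v → v ≢ replicate ℓ (+ 0) → (v ⁺) ≤coord m → (v ⁻) ≤coord m0 →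
  (m ⊟ v ⁺) ⊞ v ⁻ ≡ m0
InM-exchange-InZ {m = m} {m0} A m∈M m0-min {v} v∈Z v≢0 v⁺≤m v⁻≤m0 = begin
  (m ⊟ v ⁺) ⊞ v ⁻   ≡⟨ cong (_⊞ v ⁻) cancelled≡ ⟩
  (m0 ⊟ v ⁻) ⊞ v ⁻  ≡⟨ m⊟n⊞n≡m v⁻≤m0 ⟩
  m0                ∎
  where
  v⁺∼v⁻ : SameRep A (v ⁺) (v ⁻)
  v⁺∼v⁻ = InZ⇒SameRep⁺⁻ A v∈Z

  cancelled≡ : m ⊟ v ⁺ ≡ m0 ⊟ v ⁻
  cancelled≡ = decidable-stable (≡-dec ℕₚ._≟_ _ _) λ cancelled≢ →
    let wt⁺≡0 = InM-⊞-cancel A m∈M m0-min (m⊟n⊞n≡m v⁺≤m) (m⊟n⊞n≡m v⁻≤m0) v⁺∼v⁻ cancelled≢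
    in v≢0 (wt⁺≡0⇒wt⁻≡0⇒≡0 v wt⁺≡0 (trans (proj₁ v⁺∼v⁻) wt⁺≡0))

pos-neg-determined : (z : ℤ) (p q : ℕ) → p ≡ 0 ⊎ q ≡ 0 → pos z ≤ p → (p ∸ pos z) + neg z ≡ q →
  (pos z ≡ p) × (neg z ≡ q)
pos-neg-determined (+ k) _ _ (inj₁ refl) z≤n eq = refl , eq
pos-neg-determined (+ k) p _ (inj₂ refl) k≤p eq =
  ℕₚ.≤-antisym k≤p (ℕₚ.m∸n≡0⇒m≤n (trans (sym (ℕₚ.+-identityʳ (p ∸ k))) eq)) , refl
pos-neg-determined -[1+ k ] _ _ (inj₁ refl) _ eq = refl , eq
pos-neg-determined -[1+ k ] p _ (inj₂ refl) _ eq = ⊥-elim (ℕₚ.1+n≢0 (trans (sym (ℕₚ.+-suc p k)) eq))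

⁺⁻-determined : (v : Vec ℤ n) (m m0 : Vec ℕ n) → DisjointSupp m m0 → (v ⁺) ≤coord m →
  (m ⊟ v ⁺) ⊞ v ⁻ ≡ m0 → (v ⁺ ≡ m) × (v ⁻ ≡ m0)
⁺⁻-determined [] [] [] _ _ _ = refl , refl
⁺⁻-determined (z ∷ v) (p ∷ m) (q ∷ m0) disjoint v⁺≤m eq
  with pos-neg-determined z p q (disjoint fzero) (v⁺≤m fzero) (proj₁ (∷-injective eq))
     | ⁺⁻-determined v m m0 (λ i → disjoint (fsuc i)) (λ i → v⁺≤m (fsuc i)) (proj₂ (∷-injective eq))
... | pos≡p , neg≡q | v⁺≡m , v⁻≡m0 = cong₂ _∷_ pos≡p v⁺≡m , cong₂ _∷_ neg≡q v⁻≡m0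

mainTheorem3 : ∀ {d ℓ : ℕ} (A : Mat d ℓ) → Distinct A →
    (m : Vec ℕ ℓ) → InM A m →
    (m0 : Vec ℕ ℓ) → IsLexMin A (wt m) (Amat A m) m0 →
    DisjointSupp m m0 ×
    (∀ (v : Vec ℤ ℓ) → InZ A v → v ≢ replicate ℓ (+ 0) →
      (v ⁺) ≤coord m → (v ⁻) ≤coord m0 →
      ((v ⁺) ≡ m) × ((v ⁻) ≡ m0) × (v ≡ diff m m0))
mainTheorem3 A _ m m∈M m0 m0-min = disjoint , λ v v∈Z v≢0 v⁺≤m v⁻≤m0 →
  let exchange = InM-exchange-InZ A m∈M m0-min v∈Z v≢0 v⁺≤m v⁻≤m0
      (v⁺≡m , v⁻≡m0) = ⁺⁻-determined v m m0 disjoint v⁺≤m exchange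
  in v⁺≡m , v⁻≡m0 , trans (≡diff⁺⁻ v) (cong₂ diff v⁺≡m v⁻≡m0)
  where
  disjoint : DisjointSupp m m0
  disjoint = InM⇒DisjointSupp-lexMin A m∈M m0-min
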